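{- Let $H$ be a Heyting algebra and $a,a'\in H$. Then $a'$ is the smallest element of $\mathcal D_a(H)$ if and only if $$(a\to h)\land((h\to a)\to a)=a'\to h\quad\text{for all } h\in H.$$
   Context: For $a$ in a Heyting algebra $H$, $\mathcal D_a(H)=\{d\in H: a\le d\text{ and }(d\to a)=a\}$. -}

module Defs where

open import Level using (Level; _⊔_)
open import Data.Product using (_×_)
open import Relation.Binary.Lattice.Bundles using (HeytingAlgebra)

module _ {c ℓ₁ ℓ₂ : Level} (H : HeytingAlgebra c ℓ₁ ℓ₂) where
  open HeytingAlgebra H

  InD : Carrier → Carrier → Set (ℓ₁ ⊔ ℓ₂)
  InD a d = (a ≤ d) × ((d ⇨ a) ≈ a)

  IsSmallestD : Carrier → Carrier → Set (c ⊔ ℓ₁ ⊔ ℓ₂)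
  IsSmallestD a a' = InD a a' × (∀ d → InD a d → a' ≤ d)

-- Put φ h = (a ⇨ h) ∧ ((h ⇨ a) ⇨ a). An element d lies in 𝒟_a exactly when
-- ⊤ ≤ φ d, every d ∈ 𝒟_a satisfies d ⇨ h ≤ φ h, and φ h ⇨ h itself lies in 𝒟_a.
-- Hence if a' is least in 𝒟_a then a' ≤ φ h ⇨ h, i.e. φ h ≤ a' ⇨ h, with the
-- reverse inequality from a' ∈ 𝒟_a. Conversely, if φ h ≈ a' ⇨ h for all h, then
-- ⊤ ≈ a' ⇨ a' ≈ φ a' puts a' in 𝒟_a, and d ∈ 𝒟_a gives ⊤ ≤ φ d ≈ a' ⇨ d.
module Submission where

open import Defs
open import Level using (Level)
open import Data.Product using (_,_)
open import Function.Bundles using (_⇔_; mk⇔)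
open import Relation.Binary.Lattice.Bundles using (HeytingAlgebra)
import Relation.Binary.Lattice.Properties.HeytingAlgebra as HeytingAlgebraProperties
import Relation.Binary.Lattice.Properties.MeetSemilattice as MeetSemilatticeProperties

module _ {c ℓ₁ ℓ₂ : Level} (H : HeytingAlgebra c ℓ₁ ℓ₂) where
  open HeytingAlgebra H
  open HeytingAlgebraProperties H
    using (⇨-eval; swap-transpose-⇨; ⇨-unit; y≤x⇨y; ⇨ˡ-contravariant; ⇨-applyʳ)
  open MeetSemilatticeProperties meetSemilattice using (∧-monotonic)

  ≤⇒⊤≤⇨ : ∀ {x y} → x ≤ y → ⊤ ≤ x ⇨ y
  ≤⇒⊤≤⇨ x≤y = transpose-⇨ (trans (x∧y≤y _ _) x≤y)

  ⊤≤⇨⇒≤ : ∀ {x y} → ⊤ ≤ x ⇨ y → x ≤ y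
  ⊤≤⇨⇒≤ ⊤≤x⇨y = trans (∧-greatest (maximum _) refl) (transpose-∧ ⊤≤x⇨y)

  ≤⇨-swap : ∀ {x y z} → x ≤ y ⇨ z → y ≤ x ⇨ z
  ≤⇨-swap x≤y⇨z = swap-transpose-⇨ (transpose-∧ x≤y⇨z)

  ⇨-trans : ∀ {x y z} → (x ⇨ y) ∧ (y ⇨ z) ≤ x ⇨ z
  ⇨-trans = transpose-⇨ (trans (∧-greatest (trans (x∧y≤x _ _) (x∧y≤y _ _)) reach-y) ⇨-eval)
    where
    reach-y : ∀ {x y z} → ((x ⇨ y) ∧ (y ⇨ z)) ∧ x ≤ y
    reach-y = trans (∧-monotonic (x∧y≤x _ _) refl) ⇨-eval

  ≤-⇨-self : ∀ {x y z} → z ≤ x → z ≤ x ⇨ y → z ≤ y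
  ≤-⇨-self z≤x z≤x⇨y = trans (∧-greatest z≤x⇨y z≤x) ⇨-eval

  φ : Carrier → Carrier → Carrier
  φ a h = (a ⇨ h) ∧ ((h ⇨ a) ⇨ a)

  ∧-φ≤ : ∀ {a h} → a ∧ φ a h ≤ h
  ∧-φ≤ = trans (∧-monotonic refl (x∧y≤x _ _)) (⇨-applyʳ refl)

  ∈D⇒⊤≤φ : ∀ {a d} → InD H a d → ⊤ ≤ φ a d
  ∈D⇒⊤≤φ (a≤d , d⇨a≈a) = ∧-greatest (≤⇒⊤≤⇨ a≤d) (≤⇒⊤≤⇨ (reflexive d⇨a≈a))

  ⊤≤φ⇒∈D : ∀ {a d} → ⊤ ≤ φ a d → InD H a d
  ⊤≤φ⇒∈D ⊤≤φ =
      ⊤≤⇨⇒≤ (trans ⊤≤φ (x∧y≤x _ _))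
    , antisym (⊤≤⇨⇒≤ (trans ⊤≤φ (x∧y≤y _ _))) y≤x⇨y

  ∈D⇒⇨≤φ : ∀ {a d} h → InD H a d → d ⇨ h ≤ φ a h
  ∈D⇒⇨≤φ h (a≤d , d⇨a≈a) =
    ∧-greatest (⇨ˡ-contravariant a≤d) (transpose-⇨ (trans ⇨-trans (reflexive d⇨a≈a)))

  φ⇨-∈D : ∀ a h → InD H a (φ a h ⇨ h)
  φ⇨-∈D a h = transpose-⇨ ∧-φ≤ , antisym z≤a y≤x⇨y
    where
    -- h ≤ φ ⇨ h gives z ≤ h ⇨ a, hence z ∧ φ ≤ a ∧ φ ≤ h; so z ≤ φ ⇨ h and z
    -- applied to itself lands in a.
    z : Carrier
    z = (φ a h ⇨ h) ⇨ a
    z∧φ≤a : z ∧ φ a h ≤ a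
    z∧φ≤a = trans (∧-monotonic refl (x∧y≤y _ _)) (⇨-applyʳ (⇨ˡ-contravariant y≤x⇨y))
    z≤φ⇨h : z ≤ φ a h ⇨ h
    z≤φ⇨h = transpose-⇨ (trans (∧-greatest z∧φ≤a (x∧y≤y _ _)) ∧-φ≤)
    z≤a : z ≤ a
    z≤a = ≤-⇨-self z≤φ⇨h refl

  smallest⇒φ≈⇨ : ∀ {a a'} → IsSmallestD H a a' → ∀ h → φ a h ≈ a' ⇨ h
  smallest⇒φ≈⇨ {a} (a'∈D , least) h =
    antisym (≤⇨-swap (least _ (φ⇨-∈D a h))) (∈D⇒⇨≤φ h a'∈D)

  φ≈⇨⇒smallest : ∀ {a a'} → (∀ h → φ a h ≈ a' ⇨ h) → IsSmallestD H a a'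
  φ≈⇨⇒smallest {a' = a'} φ≈⇨ =
      ⊤≤φ⇒∈D (trans (reflexive (Eq.sym ⇨-unit)) (reflexive (Eq.sym (φ≈⇨ a'))))
    , λ d d∈D → ⊤≤⇨⇒≤ (trans (∈D⇒⊤≤φ d∈D) (reflexive (φ≈⇨ d)))

proposition2p8 : {c ℓ₁ ℓ₂ : Level} (H : HeytingAlgebra c ℓ₁ ℓ₂) → (a a' : HeytingAlgebra.Carrier H) → IsSmallestD H a a' ⇔ (∀ h → HeytingAlgebra._≈_ H (HeytingAlgebra._∧_ H (HeytingAlgebra._⇨_ H a h) (HeytingAlgebra._⇨_ H (HeytingAlgebra._⇨_ H h a) a)) (HeytingAlgebra._⇨_ H a' h))
proposition2p8 H a a' = mk⇔ (smallest⇒φ≈⇨ H) (φ≈⇨⇒smallest H)
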